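{- Let $P$ be a finite poset and let $\mu$ be the probability distribution on $J(P)$ that is uniform on a single rowmotion orbit $\mathcal O\subseteq J(P)$ and zero outside it. Then $\mu$ is toggle on antichains-symmetric: for every antichain $A$ of $P$, $\mathbb E[\mu;\mathcal T_A]=0$.
   Context: $J(P)$ is the set of order ideals of $P$; rowmotion $\mathrm{row}(I)$ is the order ideal generated by the minimal elements of $P\setminus I$. For an antichain $A$ and $I\in J(P)$: $\mathcal T_A^+(I)=1$ if $A\cap I=\emptyset$ and $I\cup A$ is an order ideal, and $0$ otherwise; $\mathcal T_A^-(I)=1$ if $A\subseteq I$ and $I\setminus A$ is an order ideal, and $0$ otherwise; $\mathcal T_A=\mathcal T_A^+-\mathcal T_A^-$. $\mathbb E[\mu;f]$ is the expectation of $f$ under $\mu$. -}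

module Defs where

open import Data.Bool using (Bool; true; false; _∧_; _∨_; not; if_then_else_)
open import Data.Nat using (ℕ; zero; suc)
open import Data.Fin using (Fin)
open import Data.Fin.Subset using (Subset; _∈_; _∪_; _∩_)
open import Data.Vec using (lookup; tabulate)
open import Data.List using (allFin)
open import Data.Bool.ListAction using (all; any)
open import Data.Integer using (ℤ; _+_; _-_; 0ℤ; 1ℤ)
open import Data.Rational using (ℚ; _/_)
open import Relation.Binary.Structures using (IsDecPartialOrder)
open import Relation.Binary.PropositionalEquality using (_≡_)
open import Relation.Nullary using (Dec; ⌊_⌋)

record FinPoset (n : ℕ) : Set₁ where
  field
    _≤_ : Fin n → Fin n → Set
    isDecPartialOrder : IsDecPartialOrder _≡_ _≤_
  open IsDecPartialOrder isDecPartialOrder public using (_≟_) renaming (_≤?_ to _≤?_)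

module _ {n : ℕ} (P : FinPoset n) where
  open FinPoset P

  IsOrderIdeal : Subset n → Set
  IsOrderIdeal I = ∀ x y → y ≤ x → x ∈ I → y ∈ I

  IsAntichain : Subset n → Set
  IsAntichain A = ∀ x y → x ∈ A → y ∈ A → x ≤ y → x ≡ y

  isOrderIdealᵇ : Subset n → Bool
  isOrderIdealᵇ I = all (λ x → all (λ y → not (⌊ y ≤? x ⌋ ∧ lookup I x) ∨ lookup I y) (allFin n)) (allFin n)

  minimalOfComplementᵇ : Subset n → Fin n → Bool
  minimalOfComplementᵇ I m =
    not (lookup I m) ∧
    all (λ y → not (⌊ y ≤? m ⌋ ∧ not ⌊ y ≟ m ⌋) ∨ lookup I y) (allFin n)

  -- rowmotion: the order ideal generated by the minimal elements of P \ I
  row : Subset n → Subset n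
  row I = tabulate (λ x → any (λ m → minimalOfComplementᵇ I m ∧ ⌊ x ≤? m ⌋) (allFin n))

  rowIter : ℕ → Subset n → Subset n
  rowIter zero    I = I
  rowIter (suc k) I = row (rowIter k I)

  disjointᵇ : Subset n → Subset n → Bool
  disjointᵇ A I = all (λ x → not (lookup A x ∧ lookup I x)) (allFin n)

  subsetᵇ : Subset n → Subset n → Bool
  subsetᵇ A I = all (λ x → not (lookup A x) ∨ lookup I x) (allFin n)

  minus : Subset n → Subset n → Subset n
  minus I A = tabulate (λ x → lookup I x ∧ not (lookup A x))

  𝟙 : Bool → ℤ
  𝟙 b = if b then 1ℤ else 0ℤ

  T⁺ : Subset n → Subset n → ℤ
  T⁺ A I = 𝟙 (disjointᵇ A I ∧ isOrderIdealᵇ (I ∪ A))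

  T⁻ : Subset n → Subset n → ℤ
  T⁻ A I = 𝟙 (subsetᵇ A I ∧ isOrderIdealᵇ (minus I A))

  T : Subset n → Subset n → ℤ
  T A I = T⁺ A I - T⁻ A I

sumBelow : ℕ → (ℕ → ℤ) → ℤ
sumBelow zero    f = 0ℤ
sumBelow (suc p) f = sumBelow p f + f p

-- Expectation of f under the uniform distribution on the rowmotion orbit
-- {row^k I₀ | k < p} (p = orbit size, the elements row^k I₀, k<p, being distinct)
expectOrbit : ∀ {n} (P : FinPoset n) (I₀ : Subset n) (p : ℕ) .{{_ : Data.Nat.NonZero p}}
              → (Subset n → ℤ) → ℚ
expectOrbit P I₀ p f = sumBelow p (λ k → f (rowIter P k I₀)) / p

-- Toggling A into an order ideal I is possible exactly when every element of A is
-- minimal in P ∖ I. These are precisely the maximal elements of row(I), so for an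
-- antichain A the same condition says that A can be toggled out of row(I). Hence
-- T⁺_A(I) = T⁻_A(row I), and the sum of T_A = T⁺_A − T⁻_A over a rowmotion orbit
-- telescopes to 0.
module Submission where

open import Defs
open import Data.Bool using (Bool; false; true; not; _∧_; _∨_) renaming (T to IsTrue)
open import Data.Bool.ListAction using (all; any)
open import Data.Bool.Properties using (T-∧; T-≡)
open import Data.Empty using (⊥-elim)
open import Data.Fin using (Fin)
open import Data.Fin.Subset using (Subset; _∈_; _∉_; _⊆_; _∪_)
open import Data.Fin.Subset.Properties using (_∈?_; x∈p∪q⁺; x∈p∪q⁻)
open import Data.Integer using (ℤ; _+_; _-_; 0ℤ)
open import Data.Integer.Properties using (+-inverseʳ)
open import Data.Integer.Solver using (module +-*-Solver)
open import Data.List using (allFin)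
open import Data.List.Membership.Propositional using (lose)
open import Data.List.Membership.Propositional.Properties using (∈-allFin)
import Data.List.Relation.Unary.All as All
open import Data.List.Relation.Unary.All.Properties using (all⁺; all⁻)
open import Data.List.Relation.Unary.Any using (satisfied)
open import Data.List.Relation.Unary.Any.Properties using (any⁺; any⁻)
open import Data.Nat using (ℕ; NonZero; _<_; zero; suc)
open import Data.Product using (_×_; _,_; proj₁; proj₂; ∃-syntax)
open import Data.Product.Function.NonDependent.Propositional using (_×-⇔_)
open import Data.Rational using (0ℚ; _/_)
open import Data.Rational.Properties using (0/n≡0)
open import Data.Sum using (inj₁; inj₂)
open import Data.Unit using (tt)
open import Data.Vec using (lookup; tabulate)
open import Data.Vec.Properties using ([]=⇒lookup; lookup⇒[]=; lookup∘tabulate)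
open import Function using (_∘_)
open import Function.Bundles using (_⇔_; mk⇔; module Equivalence)
open import Function.Properties.Equivalence using () renaming (trans to ⇔-trans; sym to ⇔-sym)
open import Relation.Binary.Structures using (IsDecPartialOrder)
open import Relation.Binary.PropositionalEquality
  using (_≡_; _≢_; refl; sym; cong; cong₂; subst; module ≡-Reasoning)
open import Relation.Nullary using (¬_; yes; no; ⌊_⌋; contradiction)
open import Relation.Nullary.Decidable using (toWitness; fromWitness)

open Equivalence using (to; from)

T-not : ∀ {b} → IsTrue (not b) ⇔ (¬ IsTrue b)
T-not {false} = mk⇔ (λ _ ()) (λ _ → tt)
T-not {true}  = mk⇔ (λ ()) (λ ¬t → ¬t tt)

T-implies : ∀ {b c} → IsTrue (not b ∨ c) ⇔ (IsTrue b → IsTrue c)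
T-implies {false} = mk⇔ (λ _ ()) (λ _ → tt)
T-implies {true}  = mk⇔ (λ t _ → t) (λ f → f tt)

T-injective : ∀ {b c} → IsTrue b ⇔ IsTrue c → b ≡ c
T-injective {false} {false} _ = refl
T-injective {false} {true}  e = ⊥-elim (from e tt)
T-injective {true}  {false} e = ⊥-elim (to e tt)
T-injective {true}  {true}  _ = refl

T-all-allFin : ∀ {n} (p : Fin n → Bool) → IsTrue (all p (allFin n)) ⇔ (∀ x → IsTrue (p x))
T-all-allFin p = mk⇔ (λ t x → All.lookup (all⁺ p _ t) (∈-allFin x))
                     (λ h → all⁻ p {xs = allFin _} (All.tabulate (λ {x} _ → h x)))

T-any-allFin : ∀ {n} (p : Fin n → Bool) → IsTrue (any p (allFin n)) ⇔ (∃[ x ] IsTrue (p x))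
T-any-allFin {n} p = mk⇔ (satisfied ∘ any⁻ p (allFin n))
                         (λ (x , t) → any⁺ {xs = allFin n} p (lose (∈-allFin x) t))

∈⇔T-lookup : ∀ {n} (J : Subset n) {x} → x ∈ J ⇔ IsTrue (lookup J x)
∈⇔T-lookup J {x} = mk⇔ (λ x∈J → from T-≡ ([]=⇒lookup x∈J))
                       (λ t → lookup⇒[]= x J (to T-≡ t))

∈-tabulate : ∀ {n} (f : Fin n → Bool) {x} → x ∈ tabulate f ⇔ IsTrue (f x)
∈-tabulate f {x} = mk⇔
  (λ x∈ → subst IsTrue (lookup∘tabulate f x) (to (∈⇔T-lookup (tabulate f)) x∈))
  (λ t → from (∈⇔T-lookup (tabulate f)) (subst IsTrue (sym (lookup∘tabulate f x)) t))

module _ {n : ℕ} (P : FinPoset n) where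
  open FinPoset P
  open IsDecPartialOrder isDecPartialOrder using (antisym)
    renaming (refl to ≤-refl; trans to ≤-trans)

  MinimalOutside : Subset n → Fin n → Set
  MinimalOutside I m = m ∉ I × (∀ y → y ≤ m → y ≢ m → y ∈ I)

  AllMinimalOutside : Subset n → Subset n → Set
  AllMinimalOutside I A = ∀ {a} → a ∈ A → MinimalOutside I a

  T-isOrderIdealᵇ : ∀ J → IsTrue (isOrderIdealᵇ P J) ⇔ IsOrderIdeal P J
  T-isOrderIdealᵇ J = mk⇔ ideal idealᵇ
    where
    closed : Fin n → Fin n → Bool
    closed x y = not (⌊ y ≤? x ⌋ ∧ lookup J x) ∨ lookup J y
    closed⇔ : ∀ x y → IsTrue (closed x y) ⇔ (y ≤ x → x ∈ J → y ∈ J)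
    closed⇔ x y = mk⇔
      (λ t y≤x x∈J → from (∈⇔T-lookup J) (to T-implies t
        (from T-∧ (fromWitness y≤x , to (∈⇔T-lookup J) x∈J))))
      (λ h → from T-implies λ t → let y≤x , x∈J = to (T-∧ {⌊ y ≤? x ⌋}) t in
        to (∈⇔T-lookup J) (h (toWitness y≤x) (from (∈⇔T-lookup J) x∈J)))
    ideal : IsTrue (isOrderIdealᵇ P J) → IsOrderIdeal P J
    ideal t x y = to (closed⇔ x y)
      (to (T-all-allFin (closed x)) (to (T-all-allFin (λ x → all (closed x) (allFin n))) t x) y)
    idealᵇ : IsOrderIdeal P J → IsTrue (isOrderIdealᵇ P J)
    idealᵇ h = from (T-all-allFin (λ x → all (closed x) (allFin n))) λ x →
      from (T-all-allFin (closed x)) λ y → from (closed⇔ x y) (h x y)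

  T-minimalOfComplementᵇ : ∀ I m → IsTrue (minimalOfComplementᵇ P I m) ⇔ MinimalOutside I m
  T-minimalOfComplementᵇ I m = mk⇔ minimal minimalᵇ
    where
    inI-if-below : Fin n → Bool
    inI-if-below y = not (⌊ y ≤? m ⌋ ∧ not ⌊ y ≟ m ⌋) ∨ lookup I y
    inI-if-below⇔ : ∀ y → IsTrue (inI-if-below y) ⇔ (y ≤ m → y ≢ m → y ∈ I)
    inI-if-below⇔ y = mk⇔
      (λ t y≤m y≢m → from (∈⇔T-lookup I) (to T-implies t
        (from (T-∧ {⌊ y ≤? m ⌋})
          (fromWitness y≤m , from T-not (y≢m ∘ toWitness {a? = y ≟ m})))))
      (λ h → from T-implies λ t → let y≤m , y≢ᵇm = to (T-∧ {⌊ y ≤? m ⌋}) t in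
        to (∈⇔T-lookup I) (h (toWitness y≤m) (to T-not y≢ᵇm ∘ fromWitness)))
    minimal : IsTrue (minimalOfComplementᵇ P I m) → MinimalOutside I m
    minimal t = let m∉ᵇ , belowᵇ = to (T-∧ {not (lookup I m)}) t in
      to T-not m∉ᵇ ∘ to (∈⇔T-lookup I) ,
      λ y → to (inI-if-below⇔ y) (to (T-all-allFin inI-if-below) belowᵇ y)
    minimalᵇ : MinimalOutside I m → IsTrue (minimalOfComplementᵇ P I m)
    minimalᵇ (m∉I , below) = from T-∧ (from T-not (m∉I ∘ from (∈⇔T-lookup I)) ,
      from (T-all-allFin inI-if-below) λ y → from (inI-if-below⇔ y) (below y))

  T-disjointᵇ : ∀ A I → IsTrue (disjointᵇ P A I) ⇔ (∀ {x} → x ∈ A → x ∉ I)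
  T-disjointᵇ A I = mk⇔
    (λ t {x} x∈A x∈I → to T-not (to (T-all-allFin apart) t x)
      (from T-∧ (to (∈⇔T-lookup A) x∈A , to (∈⇔T-lookup I) x∈I)))
    (λ h → from (T-all-allFin apart) λ x → from T-not λ t →
      let x∈A , x∈I = to (T-∧ {lookup A x}) t in
      h (from (∈⇔T-lookup A) x∈A) (from (∈⇔T-lookup I) x∈I))
    where
    apart : Fin n → Bool
    apart x = not (lookup A x ∧ lookup I x)

  T-subsetᵇ : ∀ A I → IsTrue (subsetᵇ P A I) ⇔ A ⊆ I
  T-subsetᵇ A I = mk⇔
    (λ t {x} x∈A → from (∈⇔T-lookup I) (to T-implies (to (T-all-allFin included) t x)
      (to (∈⇔T-lookup A) x∈A)))
    (λ h → from (T-all-allFin included) λ x →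
      from T-implies (to (∈⇔T-lookup I) ∘ h ∘ from (∈⇔T-lookup A)))
    where
    included : Fin n → Bool
    included x = not (lookup A x) ∨ lookup I x

  ∈-minus : ∀ I A {x} → x ∈ minus P I A ⇔ (x ∈ I × x ∉ A)
  ∈-minus I A {x} = mk⇔
    (λ x∈ → let x∈I , x∉A = to (T-∧ {lookup I x}) (to (∈-tabulate remaining) x∈) in
      from (∈⇔T-lookup I) x∈I , to T-not x∉A ∘ to (∈⇔T-lookup A))
    (λ (x∈I , x∉A) → from (∈-tabulate remaining)
      (from T-∧ (to (∈⇔T-lookup I) x∈I , from T-not (x∉A ∘ from (∈⇔T-lookup A)))))
    where
    remaining : Fin n → Bool
    remaining x = lookup I x ∧ not (lookup A x)

  ∈-row : ∀ I {x} → x ∈ row P I ⇔ (∃[ m ] MinimalOutside I m × x ≤ m)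
  ∈-row I {x} = mk⇔
    (λ x∈ → let m , t = to (T-any-allFin (generates x)) (to (∈-tabulate generated) x∈)
                min , x≤m = to (T-∧ {minimalOfComplementᵇ P I m}) t
            in m , to (T-minimalOfComplementᵇ I m) min , toWitness x≤m)
    (λ (m , min , x≤m) → from (∈-tabulate generated) (from (T-any-allFin (generates x))
      (m , from T-∧ (from (T-minimalOfComplementᵇ I m) min , fromWitness x≤m))))
    where
    generates : Fin n → Fin n → Bool
    generates z m = minimalOfComplementᵇ P I m ∧ ⌊ z ≤? m ⌋
    generated : Fin n → Bool
    generated z = any (generates z) (allFin n)

  row-isOrderIdeal : ∀ I → IsOrderIdeal P (row P I)
  row-isOrderIdeal I x y y≤x x∈row =
    let m , min , x≤m = to (∈-row I) x∈row in from (∈-row I) (m , min , ≤-trans y≤x x≤m)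

  rowIter-isOrderIdeal : ∀ {I} → IsOrderIdeal P I → ∀ k → IsOrderIdeal P (rowIter P k I)
  rowIter-isOrderIdeal ideal zero    = ideal
  rowIter-isOrderIdeal ideal (suc k) = row-isOrderIdeal (rowIter P k _)

  minimalOutside⇒maximalInRow : ∀ {I a x} → MinimalOutside I a → a ≤ x → x ∈ row P I → x ≡ a
  minimalOutside⇒maximalInRow {I} {a} (a∉I , _) a≤x x∈row with to (∈-row I) x∈row
  ... | m , (_ , below-m) , x≤m with a ≟ m
  ...   | yes refl = antisym x≤m a≤x
  ...   | no a≢m   = contradiction (below-m a (≤-trans a≤x x≤m) a≢m) a∉I

  addable⇔allMinimalOutside : ∀ {A I} → IsAntichain P A → IsOrderIdeal P I →
    ((∀ {x} → x ∈ A → x ∉ I) × IsOrderIdeal P (I ∪ A)) ⇔ AllMinimalOutside I A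
  addable⇔allMinimalOutside {A} {I} antichain ideal = mk⇔ minimal addable
    where
    minimal : (∀ {x} → x ∈ A → x ∉ I) × IsOrderIdeal P (I ∪ A) → AllMinimalOutside I A
    minimal (disjoint , ideal∪) {a} a∈A = disjoint a∈A , below
      where
      below : ∀ y → y ≤ a → y ≢ a → y ∈ I
      below y y≤a y≢a with x∈p∪q⁻ I A (ideal∪ a y y≤a (x∈p∪q⁺ (inj₂ a∈A)))
      ... | inj₁ y∈I = y∈I
      ... | inj₂ y∈A = contradiction (antichain y a y∈A a∈A y≤a) y≢a
    addable : AllMinimalOutside I A → (∀ {x} → x ∈ A → x ∉ I) × IsOrderIdeal P (I ∪ A)
    addable min = (λ a∈A → proj₁ (min a∈A)) , ideal∪
      where
      ideal∪ : IsOrderIdeal P (I ∪ A)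
      ideal∪ x y y≤x x∈I∪A with x∈p∪q⁻ I A x∈I∪A
      ... | inj₁ x∈I = x∈p∪q⁺ (inj₁ (ideal x y y≤x x∈I))
      ... | inj₂ x∈A with y ≟ x
      ...   | yes refl = x∈p∪q⁺ (inj₂ x∈A)
      ...   | no y≢x   = x∈p∪q⁺ (inj₁ (proj₂ (min x∈A) y y≤x y≢x))

  removableFromRow⇔allMinimalOutside : ∀ {A I} → IsAntichain P A →
    (A ⊆ row P I × IsOrderIdeal P (minus P (row P I) A)) ⇔ AllMinimalOutside I A
  removableFromRow⇔allMinimalOutside {A} {I} antichain = mk⇔ minimal removable
    where
    minimal : A ⊆ row P I × IsOrderIdeal P (minus P (row P I) A) → AllMinimalOutside I A
    minimal (A⊆row , ideal∖) {a} a∈A with to (∈-row I) (A⊆row a∈A)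
    ... | m , min , a≤m with m ∈? A
    ...   | yes m∈A = subst (MinimalOutside I) (sym (antichain a m a∈A m∈A a≤m)) min
    ...   | no m∉A  =
      contradiction a∈A (proj₂ (to (∈-minus (row P I) A) (ideal∖ m a a≤m m∈row∖A)))
      where m∈row∖A = from (∈-minus (row P I) A) (from (∈-row I) (m , min , ≤-refl) , m∉A)
    removable : AllMinimalOutside I A → A ⊆ row P I × IsOrderIdeal P (minus P (row P I) A)
    removable min = (λ a∈A → from (∈-row I) (_ , min a∈A , ≤-refl)) , ideal∖
      where
      ideal∖ : IsOrderIdeal P (minus P (row P I) A)
      ideal∖ x y y≤x x∈ with to (∈-minus (row P I) A) x∈
      ... | x∈row , x∉A = from (∈-minus (row P I) A) (row-isOrderIdeal I x y y≤x x∈row , y∉A)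
        where
        y∉A : y ∉ A
        y∉A y∈A =
          x∉A (subst (_∈ A) (sym (minimalOutside⇒maximalInRow (min y∈A) y≤x x∈row)) y∈A)

  T⁺≡T⁻∘row : ∀ {A I} → IsAntichain P A → IsOrderIdeal P I → T⁺ P A I ≡ T⁻ P A (row P I)
  T⁺≡T⁻∘row {A} {I} antichain ideal =
    cong (𝟙 P) (T-injective (⇔-trans togglesIn (⇔-sym togglesOutOfRow)))
    where
    togglesIn : IsTrue (disjointᵇ P A I ∧ isOrderIdealᵇ P (I ∪ A)) ⇔ AllMinimalOutside I A
    togglesIn = ⇔-trans (⇔-trans T-∧ (T-disjointᵇ A I ×-⇔ T-isOrderIdealᵇ (I ∪ A)))
                        (addable⇔allMinimalOutside antichain ideal)
    togglesOutOfRow : IsTrue (subsetᵇ P A (row P I) ∧ isOrderIdealᵇ P (minus P (row P I) A))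
                      ⇔ AllMinimalOutside I A
    togglesOutOfRow =
      ⇔-trans (⇔-trans T-∧ (T-subsetᵇ A (row P I) ×-⇔ T-isOrderIdealᵇ (minus P (row P I) A)))
              (removableFromRow⇔allMinimalOutside antichain)

sumBelow-cong : ∀ p {f g : ℕ → ℤ} → (∀ k → f k ≡ g k) → sumBelow p f ≡ sumBelow p g
sumBelow-cong zero    f≗g = refl
sumBelow-cong (suc p) f≗g = cong₂ _+_ (sumBelow-cong p f≗g) (f≗g p)

sumBelow-telescope : ∀ p (g : ℕ → ℤ) → sumBelow p (λ k → g (suc k) - g k) ≡ g p - g 0
sumBelow-telescope zero    g = sym (+-inverseʳ (g 0))
sumBelow-telescope (suc p) g = begin
    sumBelow p (λ k → g (suc k) - g k) + (g (suc p) - g p)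
  ≡⟨ cong (_+ (g (suc p) - g p)) (sumBelow-telescope p g) ⟩
    (g p - g 0) + (g (suc p) - g p)
  ≡⟨ solve 3 (λ a b c → (a :- b) :+ (c :- a) := c :- b) refl (g p) (g 0) (g (suc p)) ⟩
    g (suc p) - g 0 ∎
  where
  open ≡-Reasoning
  open +-*-Solver

lemma6p2 : ∀ {n} (P : FinPoset n) (I₀ : Subset n) → IsOrderIdeal P I₀
           → (p : ℕ) .{{_ : NonZero p}}
           → rowIter P p I₀ ≡ I₀
           → (∀ k → 0 < k → k < p → rowIter P k I₀ ≢ I₀)
           → (A : Subset n) → IsAntichain P A
           → expectOrbit P I₀ p (T P A) ≡ 0ℚ
-- The sum telescopes over any period.
lemma6p2 P I₀ I₀-ideal p period _ A antichain = begin
    expectOrbit P I₀ p (T P A)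
  ≡⟨ cong (_/ p) orbitSum≡0 ⟩
    0ℤ / p
  ≡⟨ 0/n≡0 p ⟩
    0ℚ ∎
  where
  open ≡-Reasoning
  T⁻ₖ : ℕ → ℤ
  T⁻ₖ k = T⁻ P A (rowIter P k I₀)
  orbitSum≡0 : sumBelow p (λ k → T P A (rowIter P k I₀)) ≡ 0ℤ
  orbitSum≡0 = begin
      sumBelow p (λ k → T P A (rowIter P k I₀))
    ≡⟨ sumBelow-cong p (λ k →
         cong (_- T⁻ₖ k) (T⁺≡T⁻∘row P antichain (rowIter-isOrderIdeal P I₀-ideal k))) ⟩
      sumBelow p (λ k → T⁻ₖ (suc k) - T⁻ₖ k)
    ≡⟨ sumBelow-telescope p T⁻ₖ ⟩
      T⁻ₖ p - T⁻ₖ 0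
    ≡⟨ cong (λ J → T⁻ P A J - T⁻ₖ 0) period ⟩
      T⁻ₖ 0 - T⁻ₖ 0
    ≡⟨ +-inverseʳ (T⁻ₖ 0) ⟩
      0ℤ ∎
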